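{- For every $n\in\mathbb{N}$, $\tilde{R}(\dot C^{(rbr)}_{2},Q_n)=\tilde{R}(\dot C^{(rbr)}_{3},Q_n)=2n$.
   Context: $Q_N$ denotes the Boolean lattice of all subsets of an $N$-element set ordered by inclusion. An (induced) copy of a poset $P$ in a poset $Q$ is a subset of $Q$ which, with the inherited order, is isomorphic to $P$. A colored poset $\dot P$ is a poset with a coloring of its elements in blue and red; a copy of $\dot P$ in a colored $Q$ is an induced copy of $P$ whose vertices have the same colors as the corresponding vertices of $\dot P$. $\dot Q_n^{(b)}$ (resp. $\dot Q_n^{(r)}$) is $Q_n$ colored entirely blue (resp. red). $\tilde{R}(\dot P,Q_n)$ is the minimum $N$ such that every blue/red coloring of $Q_N$ contains a copy of $\dot P$, of $\dot Q_n^{(b)}$, or of $\dot Q_n^{(r)}$. The red-alternating chain $\dot C_t^{(rbr)}$ is a chain on $t$ vertices colored alternately red and blue along the chain, with the minimal vertex red. -}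

module Defs where

open import Data.Nat using (ℕ; zero; suc; _*_; _<_)

open import Data.Fin using (Fin; toℕ) renaming (_≤_ to _≤ᶠ_)
open import Data.Fin.Subset using (Subset; _⊆_)
open import Data.Product using (Σ; _×_)
open import Data.Sum using (_⊎_)
open import Relation.Nullary using (¬_)
open import Relation.Binary.PropositionalEquality using (_≡_)
open import Function.Definitions using (Injective)
open import Function.Bundles using (_⇔_)

data Color : Set where
  blue red : Color

record ColoredPoset : Set₁ where
  field
    Carrier : Set
    _≤_     : Carrier → Carrier → Set
    color   : Carrier → Color
open ColoredPoset public

Q : ℕ → Set
Q N = Subset N

Coloring : ℕ → Set
Coloring N = Q N → Color

monoQ : ℕ → Color → ColoredPoset
monoQ n c = record { Carrier = Q n ; _≤_ = _⊆_ ; color = λ _ → c }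

CopyIn : (P : ColoredPoset) (N : ℕ) (χ : Coloring N) → Set
CopyIn P N χ =
  Σ (Carrier P → Q N) λ f →
      Injective _≡_ _≡_ f
    × (∀ x y → (_≤_ P x y ⇔ f x ⊆ f y))
    × (∀ x → χ (f x) ≡ color P x)

Arrows : ColoredPoset → ℕ → ℕ → Set
Arrows P n N = ∀ (χ : Coloring N) →
  CopyIn P N χ ⊎ (CopyIn (monoQ n blue) N χ ⊎ CopyIn (monoQ n red) N χ)

RtildeIs : ColoredPoset → ℕ → ℕ → Set
RtildeIs P n m = Arrows P n m × (∀ N → N < m → ¬ Arrows P n N)

-- Red-alternating chain on t vertices: Fin t with its usual order,
-- vertex i (counted from the minimum, starting at 0) red iff i is even.
parityColor : ℕ → Color
parityColor zero          = red
parityColor (suc zero) = blue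
parityColor (suc (suc k)) = parityColor k

chainRBR : ℕ → ColoredPoset
chainRBR t = record { Carrier = Fin t ; _≤_ = _≤ᶠ_ ; color = λ i → parityColor (toℕ i) }

module Submission where

-- Lower bound: colour the subsets of size < n blue and the others red. No red set lies below a
-- blue one, so there is no red–blue chain; a copy of Q_n spans at least n consecutive sizes, which
-- a blue copy cannot do below n and a red copy, starting at size ≥ n, cannot do below 2n.
-- Upper bound: read Q_{2n} as Q_n × Q_n, the pair (S, T) being S ++ T. If S₀ ⊆ S₁ with (S₀, ∅)
-- and (S₁, ⊤) red, then either some (S₀, T) is blue, giving a red–blue–red chain, or S₀ × Q_n is
-- a red Q_n. Otherwise S ↦ (S, ⊤ if some (S₀, ∅) with S₀ ⊆ S is red, else ∅) is a blue Q_n.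
-- Since C₂ embeds in C₃, both bounds hold for both chains.

open import Defs
open import Data.Nat using (ℕ; _*_)
open import Data.Product using (_×_)

open import Data.Nat using (zero; suc; _+_; _<?_; _<_; s≤s; z≤n) renaming (_≤_ to _≤ℕ_)
import Data.Nat.Properties as ℕ
open import Data.Product using (_,_; ∃-syntax)
open import Data.Sum using (_⊎_; inj₁; inj₂)
open import Data.Empty using (⊥-elim)
open import Data.Vec using ([]; _∷_; _++_; here; there)
open import Data.Vec.Properties using (++-injectiveˡ; ++-injectiveʳ)
open import Data.Fin using (Fin; toℕ; inject₁) renaming (zero to fz; suc to fs; _≤_ to _≤ᶠ_)
open import Data.Fin.Properties using (inject₁-injective; toℕ-inject₁) renaming (≤-reflexive to ≤ᶠ-reflexive; _≤?_ to _≤ᶠ?_)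
open import Data.Fin.Subset using (Subset; _⊆_; ⊤; ⊥; ∣_∣; inside; outside)
open import Data.Fin.Subset.Properties
  using (drop-∷-⊆; out⊆; s⊆s; ⊆-refl; ⊆-trans; ⊆-antisym; ⊥⊆; ⊆⊤; _⊆?_; anySubset?; p⊆q⇒∣p∣≤∣q∣; ∣p∣≤n)
open import Relation.Nullary using (¬_; Dec; yes; no; contradiction)
open import Relation.Nullary.Decidable using (_×-dec_)
open import Relation.Binary.PropositionalEquality using (_≡_; _≢_; refl; sym; trans; cong; subst; subst₂)
open import Function using (_∘_)
open import Function.Bundles using (_⇔_; mk⇔; Equivalence)
open import Function.Definitions using (Injective)
import Function.Properties.Equivalence as ⇔

open Equivalence using (to)

_≟ᶜ_ : (c d : Color) → Dec (c ≡ d)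
blue ≟ᶜ blue = yes refl
blue ≟ᶜ red  = no λ ()
red  ≟ᶜ blue = no λ ()
red  ≟ᶜ red  = yes refl

≢red⇒≡blue : ∀ {c} → c ≢ red → c ≡ blue
≢red⇒≡blue {blue} _   = refl
≢red⇒≡blue {red}  c≢r = contradiction refl c≢r

≢blue⇒≡red : ∀ {c} → c ≢ blue → c ≡ red
≢blue⇒≡red {red}  _   = refl
≢blue⇒≡red {blue} c≢b = contradiction refl c≢b

red-blue-distinct : ∀ {A : Set} (χ : A → Color) {x y} → χ x ≡ red → χ y ≡ blue → x ≢ y
red-blue-distinct χ χx≡r χy≡b refl with trans (sym χx≡r) χy≡b
... | ()

_↪_ : ColoredPoset → ColoredPoset → Set
P ↪ P′ =
  ∃[ h ] Injective _≡_ _≡_ h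
       × (∀ x y → _≤_ P x y ⇔ _≤_ P′ (h x) (h y))
       × (∀ x → color P′ (h x) ≡ color P x)

CopyIn-↪ : ∀ {P P′ N} {χ : Coloring N} → P ↪ P′ → CopyIn P′ N χ → CopyIn P N χ
CopyIn-↪ (h , h-inj , h-ord , h-col) (f , f-inj , f-ord , f-col) =
  f ∘ h , h-inj ∘ f-inj , (λ x y → ⇔.trans (h-ord x y) (f-ord (h x) (h y))) ,
  (λ x → trans (f-col (h x)) (h-col x))

Arrows-↪ : ∀ {P P′ n N} → P ↪ P′ → Arrows P′ n N → Arrows P n N
Arrows-↪ P↪P′ arrows χ with arrows χ
... | inj₁ copy = inj₁ (CopyIn-↪ {χ = χ} P↪P′ copy)
... | inj₂ cube = inj₂ cube

chainRBR-↪ : ∀ t → chainRBR t ↪ chainRBR (suc t)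
chainRBR-↪ t = inject₁ , inject₁-injective , ord , cong parityColor ∘ toℕ-inject₁
  where
  ord : ∀ i j → i ≤ᶠ j ⇔ inject₁ i ≤ᶠ inject₁ j
  ord i j = mk⇔ (subst₂ _≤ℕ_ (sym (toℕ-inject₁ i)) (sym (toℕ-inject₁ j)))
                (subst₂ _≤ℕ_ (toℕ-inject₁ i) (toℕ-inject₁ j))

++-mono-⊆ : ∀ {m k} {S S′ : Subset m} {T T′ : Subset k} → S ⊆ S′ → T ⊆ T′ → S ++ T ⊆ S′ ++ T′
++-mono-⊆ {S = []}          {[]}           _    T⊆T′ = T⊆T′
++-mono-⊆ {S = outside ∷ S} {_ ∷ S′}       S⊆S′ T⊆T′ = out⊆ (++-mono-⊆ {S = S} {S′} (drop-∷-⊆ S⊆S′) T⊆T′)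
++-mono-⊆ {S = inside ∷ S}  {inside ∷ S′}  S⊆S′ T⊆T′ = s⊆s (++-mono-⊆ {S = S} {S′} (drop-∷-⊆ S⊆S′) T⊆T′)
++-mono-⊆ {S = inside ∷ S}  {outside ∷ S′} S⊆S′ _ with S⊆S′ here
... | ()

++-⊆⁻ˡ : ∀ {m k} {S S′ : Subset m} {T T′ : Subset k} → S ++ T ⊆ S′ ++ T′ → S ⊆ S′
++-⊆⁻ˡ {S = _ ∷ _} {_ ∷ _} ⊆++ here with ⊆++ here
... | here = here
++-⊆⁻ˡ {S = _ ∷ S} {_ ∷ S′} {T} {T′} ⊆++ (there x∈S) =
  there (++-⊆⁻ˡ {S = S} {S′} {T} {T′} (drop-∷-⊆ ⊆++) x∈S)

++-⊆⁻ʳ : ∀ {m k} {S S′ : Subset m} {T T′ : Subset k} → S ++ T ⊆ S′ ++ T′ → T ⊆ T′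
++-⊆⁻ʳ {S = []}    {[]}     ⊆++ = ⊆++
++-⊆⁻ʳ {S = _ ∷ S} {_ ∷ S′} ⊆++ = ++-⊆⁻ʳ {S = S} {S′} (drop-∷-⊆ ⊆++)

p⊆q∧p≢q⇒∣p∣<∣q∣ : ∀ {n} {p q : Subset n} → p ⊆ q → p ≢ q → ∣ p ∣ < ∣ q ∣
p⊆q∧p≢q⇒∣p∣<∣q∣ {p = []}          {[]}          _   p≢q = contradiction refl p≢q
p⊆q∧p≢q⇒∣p∣<∣q∣ {p = outside ∷ p} {outside ∷ q} p⊆q p≢q =
  p⊆q∧p≢q⇒∣p∣<∣q∣ (drop-∷-⊆ p⊆q) (p≢q ∘ cong (outside ∷_))
p⊆q∧p≢q⇒∣p∣<∣q∣ {p = outside ∷ p} {inside ∷ q}  p⊆q _   = s≤s (p⊆q⇒∣p∣≤∣q∣ (drop-∷-⊆ p⊆q))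
p⊆q∧p≢q⇒∣p∣<∣q∣ {p = inside ∷ p}  {outside ∷ q} p⊆q _ with p⊆q here
... | ()
p⊆q∧p≢q⇒∣p∣<∣q∣ {p = inside ∷ p}  {inside ∷ q}  p⊆q p≢q =
  s≤s (p⊆q∧p≢q⇒∣p∣<∣q∣ (drop-∷-⊆ p⊆q) (p≢q ∘ cong (inside ∷_)))

-- g maps the maximal chain ⊥ ⊂ … ⊂ ⊤ of Q_n to a strict chain, whose sizes strictly increase.
∣g⊥∣+n≤∣g⊤∣ : ∀ n {N} (g : Subset n → Subset N) →
              (∀ {S S′} → S ⊆ S′ → g S ⊆ g S′) → Injective _≡_ _≡_ g →
              ∣ g ⊥ ∣ + n ≤ℕ ∣ g ⊤ ∣
∣g⊥∣+n≤∣g⊤∣ zero    g _    _     = ℕ.≤-reflexive (ℕ.+-identityʳ _)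
∣g⊥∣+n≤∣g⊤∣ (suc n) g mono g-inj = begin
  ∣ g ⊥ ∣ + suc n            ≡⟨ ℕ.+-suc ∣ g ⊥ ∣ n ⟩
  suc (∣ g ⊥ ∣ + n)          ≤⟨ s≤s (∣g⊥∣+n≤∣g⊤∣ n (g ∘ (outside ∷_)) (mono ∘ out⊆) (tail-injective ∘ g-inj)) ⟩
  suc ∣ g (outside ∷ ⊤) ∣    ≤⟨ p⊆q∧p≢q⇒∣p∣<∣q∣ (mono (out⊆ ⊆-refl)) (outside∷⊤≢⊤ ∘ g-inj) ⟩
  ∣ g ⊤ ∣                    ∎
  where
  open ℕ.≤-Reasoning
  tail-injective : ∀ {S S′ : Subset n} → outside ∷ S ≡ outside ∷ S′ → S ≡ S′
  tail-injective refl = refl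
  outside∷⊤≢⊤ : outside ∷ ⊤ {n} ≢ ⊤
  outside∷⊤≢⊤ ()

module _ {t N} {f : Fin t → Subset N} where

  monotone∧injective⇒order-embedding : (∀ {i j} → i ≤ᶠ j → f i ⊆ f j) → Injective _≡_ _≡_ f →
                                      ∀ i j → i ≤ᶠ j ⇔ f i ⊆ f j
  monotone∧injective⇒order-embedding mono f-inj i j = mk⇔ mono reflect
    where
    reflect : f i ⊆ f j → i ≤ᶠ j
    reflect fi⊆fj with i ≤ᶠ? j
    ... | yes i≤j = i≤j
    ... | no  i≰j = contradiction (≤ᶠ-reflexive (f-inj (⊆-antisym fi⊆fj (mono (ℕ.<⇒≤ (ℕ.≰⇒> i≰j)))))) i≰j

red-blue-red⇒CopyIn : ∀ {N} (χ : Coloring N) {A B C : Subset N} → A ⊆ B → B ⊆ C →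
                      χ A ≡ red → χ B ≡ blue → χ C ≡ red → CopyIn (chainRBR 3) N χ
red-blue-red⇒CopyIn {N} χ {A} {B} {C} A⊆B B⊆C χA χB χC =
  f , f-inj , monotone∧injective⇒order-embedding mono f-inj , col
  where
  f : Fin 3 → Subset N
  f fz           = A
  f (fs fz)      = B
  f (fs (fs fz)) = C
  mono : ∀ {i j} → i ≤ᶠ j → f i ⊆ f j
  mono {fz}           {fz}           _ = ⊆-refl
  mono {fz}           {fs fz}        _ = A⊆B
  mono {fz}           {fs (fs fz)}   _ = ⊆-trans A⊆B B⊆C
  mono {fs fz}        {fs fz}        _ = ⊆-refl
  mono {fs fz}        {fs (fs fz)}   _ = B⊆C
  mono {fs (fs fz)}   {fs (fs fz)}   _ = ⊆-refl
  mono {fs (fs fz)}   {fs fz}        (s≤s ())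
  A≢B : A ≢ B
  A≢B = red-blue-distinct χ χA χB
  C≢B : C ≢ B
  C≢B = red-blue-distinct χ χC χB
  A≢C : A ≢ C
  A≢C refl = A≢B (⊆-antisym A⊆B B⊆C)
  f-inj : Injective _≡_ _≡_ f
  f-inj {fz}         {fz}         _ = refl
  f-inj {fs fz}      {fs fz}      _ = refl
  f-inj {fs (fs fz)} {fs (fs fz)} _ = refl
  f-inj {fz}         {fs fz}      eq = contradiction eq A≢B
  f-inj {fz}         {fs (fs fz)} eq = contradiction eq A≢C
  f-inj {fs fz}      {fz}         eq = contradiction (sym eq) A≢B
  f-inj {fs fz}      {fs (fs fz)} eq = contradiction (sym eq) C≢B
  f-inj {fs (fs fz)} {fz}         eq = contradiction (sym eq) A≢C
  f-inj {fs (fs fz)} {fs fz}      eq = contradiction eq C≢B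
  col : ∀ i → χ (f i) ≡ parityColor (toℕ i)
  col fz           = χA
  col (fs fz)      = χB
  col (fs (fs fz)) = χC

colourOf : ∀ {P : Set} → Dec P → Color
colourOf (yes _) = blue
colourOf (no _)  = red

colourOf-blue : ∀ {P : Set} (P? : Dec P) → colourOf P? ≡ blue → P
colourOf-blue (yes p) _ = p

colourOf-red : ∀ {P : Set} (P? : Dec P) → colourOf P? ≡ red → ¬ P
colourOf-red (no ¬p) _ = ¬p

sizeColouring : ∀ {N} → ℕ → Coloring N
sizeColouring n A = colourOf (∣ A ∣ <? n)

¬Arrows-chainRBR₂ : ∀ {n N} → N < 2 * n → ¬ Arrows (chainRBR 2) n N
¬Arrows-chainRBR₂ {n} {N} N<2n arrows with arrows (sizeColouring n)
... | inj₁ (f , _ , ord , col) =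
  ℕ.<⇒≱ (colourOf-blue (∣ f (fs fz) ∣ <? n) (col (fs fz)))
        (ℕ.≤-trans (ℕ.≮⇒≥ (colourOf-red (∣ f fz ∣ <? n) (col fz)))
                   (p⊆q⇒∣p∣≤∣q∣ (to (ord fz (fs fz)) z≤n)))
... | inj₂ (inj₁ (g , g-inj , ord , col)) =
  ℕ.<⇒≱ (colourOf-blue (∣ g ⊤ ∣ <? n) (col ⊤))
        (ℕ.≤-trans (ℕ.m≤n+m n ∣ g ⊥ ∣) (∣g⊥∣+n≤∣g⊤∣ n g (to (ord _ _)) g-inj))
... | inj₂ (inj₂ (g , g-inj , ord , col)) = ℕ.<⇒≱ N<2n (begin
  2 * n            ≡⟨ cong (n +_) (ℕ.+-identityʳ n) ⟩
  n + n            ≤⟨ ℕ.+-monoˡ-≤ n (ℕ.≮⇒≥ (colourOf-red (∣ g ⊥ ∣ <? n) (col ⊥))) ⟩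
  ∣ g ⊥ ∣ + n      ≤⟨ ∣g⊥∣+n≤∣g⊤∣ n g (to (ord _ _)) g-inj ⟩
  ∣ g ⊤ ∣          ≤⟨ ∣p∣≤n (g ⊤) ⟩
  N                ∎)
  where open ℕ.≤-Reasoning

++ʳ-order-embedding : ∀ {m k} (S : Subset m) (T T′ : Subset k) → T ⊆ T′ ⇔ S ++ T ⊆ S ++ T′
++ʳ-order-embedding S T T′ = mk⇔ (++-mono-⊆ {S = S} {S} ⊆-refl) (++-⊆⁻ʳ {S = S} {S})

graph-order-embedding : ∀ {m k} (h : Subset m → Subset k) → (∀ {S S′} → S ⊆ S′ → h S ⊆ h S′) →
                        ∀ S S′ → S ⊆ S′ ⇔ S ++ h S ⊆ S′ ++ h S′
graph-order-embedding h h-mono S S′ = mk⇔ extend (++-⊆⁻ˡ {T = h S} {h S′})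
  where
  extend : S ⊆ S′ → S ++ h S ⊆ S′ ++ h S′
  extend S⊆S′ = ++-mono-⊆ {S = S} {S′} S⊆S′ (h-mono S⊆S′)

module UpperBound {n : ℕ} (χ : Coloring (n + n)) where

  RedBelow : Subset n → Set
  RedBelow S = ∃[ S₀ ] S₀ ⊆ S × χ (S₀ ++ ⊥) ≡ red

  redBelow? : ∀ S → Dec (RedBelow S)
  redBelow? S = anySubset? λ S₀ → (S₀ ⊆? S) ×-dec (χ (S₀ ++ ⊥) ≟ᶜ red)

  lift : Subset n → Subset n
  lift S with redBelow? S
  ... | yes _ = ⊤
  ... | no  _ = ⊥

  lift-mono : ∀ {S S′} → S ⊆ S′ → lift S ⊆ lift S′
  lift-mono {S} {S′} S⊆S′ with redBelow? S | redBelow? S′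
  ... | no _                    | _             = ⊥⊆
  ... | yes _                   | yes _         = ⊆-refl
  ... | yes (S₀ , S₀⊆S , χS₀) | no ¬redBelow = ⊥-elim (¬redBelow (S₀ , ⊆-trans S₀⊆S S⊆S′ , χS₀))

  lift-blue : ¬ (∃[ S ] RedBelow S × χ (S ++ ⊤) ≡ red) → ∀ S → χ (S ++ lift S) ≡ blue
  lift-blue ¬redPair S with redBelow? S
  ... | yes redBelow = ≢red⇒≡blue λ χS⊤ → ¬redPair (S , redBelow , χS⊤)
  ... | no ¬redBelow = ≢red⇒≡blue λ χS⊥ → ¬redBelow (S , ⊆-refl , χS⊥)

  arrows : CopyIn (chainRBR 3) (n + n) χ ⊎ (CopyIn (monoQ n blue) (n + n) χ ⊎ CopyIn (monoQ n red) (n + n) χ)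
  arrows with anySubset? (λ S → redBelow? S ×-dec (χ (S ++ ⊤) ≟ᶜ red))
  ... | no ¬redPair = inj₂ (inj₁ (graph , graph-inj , graph-order-embedding lift lift-mono , lift-blue ¬redPair))
    where
    graph : Subset n → Subset (n + n)
    graph S = S ++ lift S
    graph-inj : Injective _≡_ _≡_ graph
    graph-inj {S} {S′} = ++-injectiveˡ S S′
  ... | yes (S₁ , (S₀ , S₀⊆S₁ , χS₀⊥) , χS₁⊤) with anySubset? (λ T → χ (S₀ ++ T) ≟ᶜ blue)
  ...   | yes (T , χS₀T) =
    inj₁ (red-blue-red⇒CopyIn χ (++-mono-⊆ {S = S₀} ⊆-refl ⊥⊆) (++-mono-⊆ S₀⊆S₁ ⊆⊤) χS₀⊥ χS₀T χS₁⊤)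
  ...   | no ¬blue =
    inj₂ (inj₂ ((S₀ ++_) , ++-injectiveʳ S₀ S₀ , ++ʳ-order-embedding S₀ , λ T → ≢blue⇒≡red (¬blue ∘ (T ,_))))

Arrows-chainRBR₃ : ∀ n → Arrows (chainRBR 3) n (2 * n)
Arrows-chainRBR₃ n = subst (Arrows (chainRBR 3) n) (cong (n +_) (sym (ℕ.+-identityʳ n))) UpperBound.arrows

lemma6 : ∀ (n : ℕ) → RtildeIs (chainRBR 2) n (2 * n) × RtildeIs (chainRBR 3) n (2 * n)
lemma6 n =
  (Arrows-↪ (chainRBR-↪ 2) (Arrows-chainRBR₃ n) , λ _ N<2n → ¬Arrows-chainRBR₂ N<2n) ,
  (Arrows-chainRBR₃ n , λ _ N<2n → ¬Arrows-chainRBR₂ N<2n ∘ Arrows-↪ (chainRBR-↪ 2))
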